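{- For $n\ge1$, the approximating graph $G_n$ of the Diamond fractal, with vertex set $V_n$ and vertex degrees $d_1,\dots,d_{|V_n|}$, satisfies $$\frac{\prod_{i=1}^{|V_n|}d_i}{\sum_{i=1}^{|V_n|}d_i}=2^{\frac19(2\cdot4^{n+1}-6n-17)}.$$
   Context: Diamond fractal graphs: $G_1$ is the 4-cycle $a-u-b-v-a$. For $n\ge2$, $G_n$ is obtained from $G_{n-1}$ by replacing every edge $\{x,y\}$ by a 4-cycle $x-u_{xy}-y-v_{xy}-x$ with two new vertices $u_{xy},v_{xy}$ (distinct for distinct edges). -}

module Defs where

open import Data.Nat using (ℕ; zero; suc; _+_; _*_; _≡ᵇ_)
open import Data.Bool using (if_then_else_)
open import Data.List using (List; []; _∷_; length; map; upTo)
open import Data.Nat.ListAction using (sum; product)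
open import Data.Product using (_×_; _,_)

-- A finite (simple, undirected) graph with vertex set {0, …, nV - 1};
-- each undirected edge {x,y} is listed exactly once as a pair (x , y).
record Graph : Set where
  constructor mkGraph
  field
    nV    : ℕ
    edges : List (ℕ × ℕ)
open Graph public

-- Replace each edge {x,y} (the k-th edge) by the 4-cycle x - u - y - v - x,
-- where u = c + 2k and v = c + 2k + 1 are fresh vertices (c = old vertex count).
replaceEdges : ℕ → List (ℕ × ℕ) → List (ℕ × ℕ)
replaceEdges c [] = []
replaceEdges c ((x , y) ∷ es) =
  (x , c) ∷ (c , y) ∷ (y , suc c) ∷ (suc c , x) ∷ replaceEdges (suc (suc c)) es

step : Graph → Graph
step g = mkGraph (nV g + 2 * length (edges g)) (replaceEdges (nV g) (edges g))

-- diamond 0 is the single edge a - b (a = 0, b = 1);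
-- diamond 1 = step (diamond 0) is the 4-cycle a - u - b - v - a (u = 2, v = 3), i.e. G₁;
-- diamond (n+1) = step (diamond n), i.e. G_{n+1} from G_n.
diamond : ℕ → Graph
diamond zero    = mkGraph 2 ((0 , 1) ∷ [])
diamond (suc n) = step (diamond n)

degreeIn : ℕ → List (ℕ × ℕ) → ℕ
degreeIn i [] = 0
degreeIn i ((x , y) ∷ es) =
  (if x ≡ᵇ i then 1 else 0) + (if y ≡ᵇ i then 1 else 0) + degreeIn i es

degree : Graph → ℕ → ℕ
degree g i = degreeIn i (edges g)

degrees : Graph → List ℕ
degrees g = map (degree g) (upTo (nV g))

productDegrees : Graph → ℕ
productDegrees g = product (degrees g)

sumDegrees : Graph → ℕ
sumDegrees g = sum (degrees g)

module Submission where

-- One refinement step replaces every edge {x,y} of a graph with c vertices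
-- and E edges by a 4-cycle through two fresh vertices.  The degree of every
-- old vertex doubles and each of the 2E fresh vertices has degree 2, so the
-- degree sequence of the refined graph is
--     map (2 *_) (old degrees) ++ replicate (2E) 2          (degrees-step).
-- Taking sums and products of this list gives
--     Σ' = 2Σ + 4E   and   Π' = 2^c · Π · 2^(2E)             (sum/product-step).
-- For the Diamond graphs E_n = 4^n and 3|V_n| = 2·4^n + 4, hence
-- Σ_n = 2·4^n = 2^(2n+1) and Π_n = 2^(e_n) for an explicit recursive
-- exponent e_n with 9 e_n + 8 = 8·4^n + 12n.  The corollary follows since
-- the exponent of the ratio is e_n - (2n+1) = (2·4^(n+1) - 6n - 17)/9.

open import Defs
open import Data.Nat using (ℕ; suc; _+_; _*_; _∸_; _^_; _/_; _≤_)
open import Data.Nat.Divisibility using (_∣_)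
open import Data.Product using (_×_)
open import Relation.Binary.PropositionalEquality using (_≡_)

open import Data.Nat using (zero; _<_; s≤s; z≤n; z<s; _≡ᵇ_)
open import Data.Nat.Properties
open import Data.Nat.DivMod using (m*n/n≡m)
open import Data.Nat.Divisibility using (divides)
open import Data.Nat.Tactic.RingSolver using (solve-∀)
open import Data.Nat.ListAction using (sum; product)
open import Data.Nat.ListAction.Properties using (sum-++; product-++)
open import Data.Bool using (true; false; T; if_then_else_)
open import Data.Unit using (tt)
open import Data.Empty using (⊥-elim)
open import Data.Product using (_,_; proj₁; proj₂)
open import Data.List using (List; []; _∷_; _++_; length; map; upTo; applyUpTo; replicate)
open import Data.List.Properties using (map-upTo; map-applyUpTo; length-map; length-upTo)
open import Data.List.Relation.Unary.All using (All; []; _∷_)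
open import Function using (_∘_)
open import Relation.Binary.PropositionalEquality
  using (refl; sym; trans; cong; cong₂; subst; _≢_; module ≡-Reasoning)

≡ᵇ-refl : ∀ i → (i ≡ᵇ i) ≡ true
≡ᵇ-refl zero    = refl
≡ᵇ-refl (suc i) = ≡ᵇ-refl i

≢⇒≡ᵇ-false : ∀ {x i} → x ≢ i → (x ≡ᵇ i) ≡ false
≢⇒≡ᵇ-false {x} {i} x≢i with x ≡ᵇ i in eq
... | true  = ⊥-elim (x≢i (≡ᵇ⇒≡ x i (subst T (sym eq) tt)))
... | false = refl

<⇒≡ᵇ-false : ∀ {x i} → x < i → (x ≡ᵇ i) ≡ false
<⇒≡ᵇ-false = ≢⇒≡ᵇ-false ∘ <⇒≢

>⇒≡ᵇ-false : ∀ {x i} → i < x → (x ≡ᵇ i) ≡ false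
>⇒≡ᵇ-false = ≢⇒≡ᵇ-false ∘ >⇒≢

EdgesBelow : ℕ → List (ℕ × ℕ) → Set
EdgesBelow b = All (λ e → proj₁ e < b × proj₂ e < b)

-- A vertex below the first fresh label c meets each replacing 4-cycle
-- exactly twice as often as the replaced edge, so its degree doubles.
degree-old : ∀ c es i → i < c → degreeIn i (replaceEdges c es) ≡ 2 * degreeIn i es
degree-old c []             i i<c = refl
degree-old c ((x , y) ∷ es) i i<c
  rewrite >⇒≡ᵇ-false i<c | >⇒≡ᵇ-false (m<n⇒m<1+n i<c)
        | degree-old (suc (suc c)) es i (m<n⇒m<1+n (m<n⇒m<1+n i<c))
  = four-to-two (if x ≡ᵇ i then 1 else 0) (if y ≡ᵇ i then 1 else 0) (degreeIn i es)
  where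
  four-to-two : ∀ a b d → (a + 0) + ((0 + b) + ((b + 0) + ((0 + a) + 2 * d)))
                        ≡ 2 * ((a + b) + d)
  four-to-two = solve-∀

degree-unused : ∀ b c es i → b ≤ i → i < c → EdgesBelow b es →
                degreeIn i (replaceEdges c es) ≡ 0
degree-unused b c []             i b≤i i<c []                = refl
degree-unused b c ((x , y) ∷ es) i b≤i i<c ((x<b , y<b) ∷ bs)
  rewrite >⇒≡ᵇ-false i<c | >⇒≡ᵇ-false (m<n⇒m<1+n i<c)
        | <⇒≡ᵇ-false (<-≤-trans x<b b≤i) | <⇒≡ᵇ-false (<-≤-trans y<b b≤i)
        | degree-unused b (suc (suc c)) es i b≤i (m<n⇒m<1+n (m<n⇒m<1+n i<c)) bs
  = refl

b≤c+2+j : ∀ {b} c j → b ≤ c → b ≤ suc (suc (c + j))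
b≤c+2+j c j b≤c = ≤-trans b≤c (m≤n⇒m≤1+n (m≤n⇒m≤1+n (m≤m+n c j)))

-- Each of the 2·|es| fresh vertices c, c+1, … lies on exactly one 4-cycle,
-- hence has degree 2.
degree-fresh : ∀ b c es j → b ≤ c → EdgesBelow b es → j < 2 * length es →
               degreeIn (c + j) (replaceEdges c es) ≡ 2
degree-fresh b c ((x , y) ∷ es) zero b≤c ((x<b , y<b) ∷ bs) _
  rewrite +-identityʳ c | ≡ᵇ-refl c | >⇒≡ᵇ-false (n<1+n c)
        | <⇒≡ᵇ-false (<-≤-trans x<b b≤c) | <⇒≡ᵇ-false (<-≤-trans y<b b≤c)
        | degree-unused b (suc (suc c)) es c b≤c (m<n⇒m<1+n (n<1+n c)) bs
  = refl
degree-fresh b c ((x , y) ∷ es) (suc zero) b≤c ((x<b , y<b) ∷ bs) _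
  rewrite +-comm c 1 | ≡ᵇ-refl c | <⇒≡ᵇ-false (n<1+n c)
        | <⇒≡ᵇ-false (m<n⇒m<1+n (<-≤-trans x<b b≤c))
        | <⇒≡ᵇ-false (m<n⇒m<1+n (<-≤-trans y<b b≤c))
        | degree-unused b (suc (suc c)) es (suc c) (m≤n⇒m≤1+n b≤c) (n<1+n (suc c)) bs
  = refl
degree-fresh b c ((x , y) ∷ es) (suc (suc j)) b≤c ((x<b , y<b) ∷ bs) j<
  rewrite +-suc c (suc j) | +-suc c j
        | <⇒≡ᵇ-false (s≤s (m≤n⇒m≤1+n (m≤m+n c j))) | <⇒≡ᵇ-false (s≤s (s≤s (m≤m+n c j)))
        | <⇒≡ᵇ-false (<-≤-trans x<b (b≤c+2+j c j b≤c)) | <⇒≡ᵇ-false (<-≤-trans y<b (b≤c+2+j c j b≤c))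
  = degree-fresh b (suc (suc c)) es j (m≤n⇒m≤1+n (m≤n⇒m≤1+n b≤c)) bs j<′
  where
  j<′ : j < 2 * length es
  j<′ rewrite *-suc 2 (length es) = ≤-pred (≤-pred j<)

replaceEdges-below : ∀ b c B es → b ≤ c → c + 2 * length es ≤ B → EdgesBelow b es →
                     EdgesBelow B (replaceEdges c es)
replaceEdges-below b c B []             b≤c _    []                 = []
replaceEdges-below b c B ((x , y) ∷ es) b≤c c+2E≤B ((x<b , y<b) ∷ bs) =
  (x<B , c<B) ∷ (c<B , y<B) ∷ (y<B , c+1<B) ∷ (c+1<B , x<B) ∷
  replaceEdges-below b (suc (suc c)) B es (m≤n⇒m≤1+n (m≤n⇒m≤1+n b≤c)) c+2+2E≤B bs
  where
  c+2+2E≤B : suc (suc (c + 2 * length es)) ≤ B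
  c+2+2E≤B = subst (_≤ B) (trans (+-suc c _) (cong suc (+-suc c _)))
               (subst (λ k → c + k ≤ B) (*-suc 2 (length es)) c+2E≤B)
  c+1<B : suc c < B
  c+1<B = ≤-trans (s≤s (s≤s (m≤m+n c _))) c+2+2E≤B
  c<B : c < B
  c<B = <-trans (n<1+n c) c+1<B
  x<B : x < B
  x<B = <-trans (<-≤-trans x<b b≤c) c<B
  y<B : y < B
  y<B = <-trans (<-≤-trans y<b b≤c) c<B

length-replaceEdges : ∀ c es → length (replaceEdges c es) ≡ 4 * length es
length-replaceEdges c []       = refl
length-replaceEdges c (e ∷ es) =
  trans (cong (4 +_) (length-replaceEdges (suc (suc c)) es)) (sym (*-suc 4 (length es)))

applyUpTo-split : ∀ {A : Set} (f g : ℕ → A) (y : A) m k →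
                  (∀ i → i < m → f i ≡ g i) → (∀ j → j < k → f (m + j) ≡ y) →
                  applyUpTo f (m + k) ≡ applyUpTo g m ++ replicate k y
applyUpTo-split f g y (suc m) k f≗g f≗y =
  cong₂ _∷_ (f≗g 0 z<s)
            (applyUpTo-split (f ∘ suc) (g ∘ suc) y m k (λ i → f≗g (suc i) ∘ s≤s) f≗y)
applyUpTo-split f g y zero (suc k) f≗g f≗y =
  cong₂ _∷_ (f≗y 0 z<s) (applyUpTo-split (f ∘ suc) g y zero k (λ _ ()) (λ j → f≗y (suc j) ∘ s≤s))
applyUpTo-split f g y zero zero f≗g f≗y = refl

sum-map-scale : ∀ k xs → sum (map (k *_) xs) ≡ k * sum xs
sum-map-scale k []       = sym (*-zeroʳ k)
sum-map-scale k (x ∷ xs) = trans (cong (k * x +_) (sum-map-scale k xs)) (sym (*-distribˡ-+ k x _))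

product-map-scale : ∀ k xs → product (map (k *_) xs) ≡ k ^ length xs * product xs
product-map-scale k []       = refl
product-map-scale k (x ∷ xs) = begin
  k * x * product (map (k *_) xs)   ≡⟨ cong (k * x *_) (product-map-scale k xs) ⟩
  k * x * (k ^ length xs * product xs)  ≡⟨ regroup k x (k ^ length xs) (product xs) ⟩
  k * k ^ length xs * (x * product xs)  ∎
  where
  open ≡-Reasoning
  regroup : ∀ k x p q → k * x * (p * q) ≡ k * p * (x * q)
  regroup = solve-∀

sum-replicate : ∀ n x → sum (replicate n x) ≡ n * x
sum-replicate zero    x = refl
sum-replicate (suc n) x = cong (x +_) (sum-replicate n x)

product-replicate : ∀ n x → product (replicate n x) ≡ x ^ n
product-replicate zero    x = refl
product-replicate (suc n) x = cong (x *_) (product-replicate n x)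

length-degrees : ∀ g → length (degrees g) ≡ nV g
length-degrees g = trans (length-map (degree g) (upTo (nV g))) (length-upTo (nV g))

degrees-step : ∀ g → EdgesBelow (nV g) (edges g) →
               degrees (step g) ≡ map (2 *_) (degrees g) ++ replicate (2 * length (edges g)) 2
degrees-step g below = begin
  map D (upTo (c + 2E))                       ≡⟨ map-upTo D (c + 2E) ⟩
  applyUpTo D (c + 2E)                        ≡⟨ applyUpTo-split D ((2 *_) ∘ d) 2 c 2E
                                                   (degree-old c es) fresh ⟩
  applyUpTo ((2 *_) ∘ d) c ++ replicate 2E 2  ≡⟨ cong (_++ replicate 2E 2) doubled ⟨
  map (2 *_) (map d (upTo c)) ++ replicate 2E 2 ∎
  where
  open ≡-Reasoning
  c  = nV g
  es = edges g
  2E = 2 * length es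
  d  = degree g
  D  = degree (step g)
  fresh : ∀ j → j < 2E → D (c + j) ≡ 2
  fresh j = degree-fresh c c es j ≤-refl below
  doubled : map (2 *_) (map d (upTo c)) ≡ applyUpTo ((2 *_) ∘ d) c
  doubled = trans (cong (map (2 *_)) (map-upTo d c)) (map-applyUpTo d (2 *_) c)

sum-step : ∀ g → EdgesBelow (nV g) (edges g) →
           sumDegrees (step g) ≡ 2 * sumDegrees g + 2 * length (edges g) * 2
sum-step g below = begin
  sum (degrees (step g))                          ≡⟨ cong sum (degrees-step g below) ⟩
  sum (map (2 *_) (degrees g) ++ replicate 2E 2)  ≡⟨ sum-++ (map (2 *_) (degrees g)) _ ⟩
  sum (map (2 *_) (degrees g)) + sum (replicate 2E 2)
    ≡⟨ cong₂ _+_ (sum-map-scale 2 (degrees g)) (sum-replicate 2E 2) ⟩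
  2 * sumDegrees g + 2E * 2                       ∎
  where
  open ≡-Reasoning
  2E = 2 * length (edges g)

product-step : ∀ g → EdgesBelow (nV g) (edges g) →
               productDegrees (step g) ≡ 2 ^ nV g * productDegrees g * 2 ^ (2 * length (edges g))
product-step g below = begin
  product (degrees (step g))                          ≡⟨ cong product (degrees-step g below) ⟩
  product (map (2 *_) (degrees g) ++ replicate 2E 2)  ≡⟨ product-++ (map (2 *_) (degrees g)) _ ⟩
  product (map (2 *_) (degrees g)) * product (replicate 2E 2)
    ≡⟨ cong₂ _*_ (product-map-scale 2 (degrees g)) (product-replicate 2E 2) ⟩
  2 ^ length (degrees g) * productDegrees g * 2 ^ 2E
    ≡⟨ cong (λ k → 2 ^ k * productDegrees g * 2 ^ 2E) (length-degrees g) ⟩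
  2 ^ nV g * productDegrees g * 2 ^ 2E                ∎
  where
  open ≡-Reasoning
  2E = 2 * length (edges g)

diamond-edges : ∀ n → length (edges (diamond n)) ≡ 4 ^ n
diamond-edges zero    = refl
diamond-edges (suc n) =
  trans (length-replaceEdges (nV (diamond n)) (edges (diamond n))) (cong (4 *_) (diamond-edges n))

diamond-below : ∀ n → EdgesBelow (nV (diamond n)) (edges (diamond n))
diamond-below zero    = (z<s , s≤s z<s) ∷ []
diamond-below (suc n) =
  replaceEdges-below (nV (diamond n)) (nV (diamond n)) _ (edges (diamond n)) ≤-refl ≤-refl
                     (diamond-below n)

diamond-vertices : ∀ n → 3 * nV (diamond n) ≡ 2 * 4 ^ n + 4
diamond-vertices zero    = refl
diamond-vertices (suc n) = begin
  3 * (V + 2 * length (edges (diamond n)))  ≡⟨ cong (λ E → 3 * (V + 2 * E)) (diamond-edges n) ⟩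
  3 * (V + 2 * 4 ^ n)                       ≡⟨ expand V (4 ^ n) ⟩
  3 * V + 6 * 4 ^ n                         ≡⟨ cong (_+ 6 * 4 ^ n) (diamond-vertices n) ⟩
  2 * 4 ^ n + 4 + 6 * 4 ^ n                 ≡⟨ collect (4 ^ n) ⟩
  2 * (4 * 4 ^ n) + 4                       ∎
  where
  open ≡-Reasoning
  V = nV (diamond n)
  expand : ∀ v p → 3 * (v + 2 * p) ≡ 3 * v + 6 * p
  expand = solve-∀
  collect : ∀ p → 2 * p + 4 + 6 * p ≡ 2 * (4 * p) + 4
  collect = solve-∀

diamond-sum : ∀ n → sumDegrees (diamond n) ≡ 2 ^ (2 * n + 1)
diamond-sum n = trans (twice-edges n) power
  where
  twice-edges : ∀ n → sumDegrees (diamond n) ≡ 2 * 4 ^ n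
  twice-edges zero    = refl
  twice-edges (suc n) =
    trans (sum-step (diamond n) (diamond-below n))
          (trans (cong₂ (λ S E → 2 * S + 2 * E * 2) (twice-edges n) (diamond-edges n))
                 (collect (4 ^ n)))
    where
    collect : ∀ p → 2 * (2 * p) + 2 * p * 2 ≡ 2 * (4 * p)
    collect = solve-∀
  power : 2 * 4 ^ n ≡ 2 ^ (2 * n + 1)
  power = trans (cong (2 *_) (^-*-assoc 2 2 n)) (cong (2 ^_) (+-comm 1 (2 * n)))

-- The degree product of G_n is 2^(productExponent n): by product-step the
-- exponent grows by |V_n| + 2·4^n in each refinement step.
productExponent : ℕ → ℕ
productExponent zero    = 0
productExponent (suc n) = nV (diamond n) + productExponent n + 2 * 4 ^ n

diamond-product : ∀ n → productDegrees (diamond n) ≡ 2 ^ productExponent n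
diamond-product zero    = refl
diamond-product (suc n) = begin
  productDegrees (step (diamond n))
    ≡⟨ product-step (diamond n) (diamond-below n) ⟩
  2 ^ V * productDegrees (diamond n) * 2 ^ (2 * length (edges (diamond n)))
    ≡⟨ cong₂ (λ P E → 2 ^ V * P * 2 ^ (2 * E)) (diamond-product n) (diamond-edges n) ⟩
  2 ^ V * 2 ^ productExponent n * 2 ^ (2 * 4 ^ n)
    ≡⟨ cong (_* 2 ^ (2 * 4 ^ n)) (^-distribˡ-+-* 2 V (productExponent n)) ⟨
  2 ^ (V + productExponent n) * 2 ^ (2 * 4 ^ n)
    ≡⟨ ^-distribˡ-+-* 2 (V + productExponent n) (2 * 4 ^ n) ⟨
  2 ^ (V + productExponent n + 2 * 4 ^ n)    ∎
  where
  open ≡-Reasoning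
  V = nV (diamond n)

productExponent-closed : ∀ n → 9 * productExponent n + 8 ≡ 8 * 4 ^ n + 12 * n
productExponent-closed zero    = refl
productExponent-closed (suc n) = begin
  9 * (V + e + 2 * 4 ^ n) + 8                               ≡⟨ expand V e (4 ^ n) ⟩
  3 * (3 * V) + (9 * e + 8) + 18 * 4 ^ n
    ≡⟨ cong₂ (λ V′ e′ → 3 * V′ + e′ + 18 * 4 ^ n) (diamond-vertices n) (productExponent-closed n) ⟩
  3 * (2 * 4 ^ n + 4) + (8 * 4 ^ n + 12 * n) + 18 * 4 ^ n  ≡⟨ collect (4 ^ n) n ⟩
  8 * (4 * 4 ^ n) + 12 * suc n                              ∎
  where
  open ≡-Reasoning
  V = nV (diamond n)
  e = productExponent n
  expand : ∀ v e p → 9 * (v + e + 2 * p) + 8 ≡ 3 * (3 * v) + (9 * e + 8) + 18 * p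
  expand = solve-∀
  collect : ∀ p n → 3 * (2 * p + 4) + (8 * p + 12 * n) + 18 * p ≡ 8 * (4 * p) + 12 * suc n
  collect = solve-∀

-- For n ≥ 1 the degree product dominates the degree sum 2^(2n+1), so the
-- truncated subtraction e_n ∸ (2n+1) below is the true difference.
productExponent-lower : ∀ m → 2 * suc m + 1 ≤ productExponent (suc m)
productExponent-lower zero    = s≤s (s≤s (s≤s z≤n))
productExponent-lower (suc m) = begin
  2 * suc (suc m) + 1                    ≡⟨ shift m ⟩
  2 * suc m + 1 + 2                      ≤⟨ +-mono-≤ (productExponent-lower m) (*-monoʳ-≤ 2 (m^n>0 4 (suc m))) ⟩
  productExponent (suc m) + 2 * 4 ^ suc m
    ≤⟨ +-monoˡ-≤ (2 * 4 ^ suc m) (m≤n+m (productExponent (suc m)) (nV (diamond (suc m)))) ⟩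
  productExponent (suc (suc m))          ∎
  where
  open ≤-Reasoning
  shift : ∀ m → 2 * suc (suc m) + 1 ≡ 2 * suc m + 1 + 2
  shift = solve-∀

ratio-exponent : ∀ m → let n = suc m ; q = productExponent n ∸ (2 * n + 1) in
                 9 * q + (6 * n + 17) ≡ 2 * 4 ^ (n + 1)
ratio-exponent m = +-cancelʳ-≡ (12 * n) _ _ (begin
  9 * q + (6 * n + 17) + 12 * n  ≡⟨ regroup q n ⟨
  9 * (q + (2 * n + 1)) + 8      ≡⟨ cong (λ e → 9 * e + 8) (m∸n+n≡m (productExponent-lower m)) ⟩
  9 * productExponent n + 8      ≡⟨ productExponent-closed n ⟩
  8 * 4 ^ n + 12 * n             ≡⟨ cong (_+ 12 * n) (power n) ⟩
  2 * 4 ^ (n + 1) + 12 * n       ∎)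
  where
  open ≡-Reasoning
  n = suc m
  q = productExponent n ∸ (2 * n + 1)
  regroup : ∀ q n → 9 * (q + (2 * n + 1)) + 8 ≡ 9 * q + (6 * n + 17) + 12 * n
  regroup = solve-∀
  power : ∀ n → 8 * 4 ^ n ≡ 2 * 4 ^ (n + 1)
  power n = trans (*-assoc 2 4 (4 ^ n)) (cong (λ k → 2 * 4 ^ k) (+-comm 1 n))

corollary5p9 : ∀ (n : ℕ) → 1 ≤ n →
    (9 ∣ (2 * 4 ^ (n + 1) ∸ (6 * n + 17)))
    × (productDegrees (diamond n)
    ≡ 2 ^ ((2 * 4 ^ (n + 1) ∸ (6 * n + 17)) / 9) * sumDegrees (diamond n))
corollary5p9 (suc m) _ = divides q numerator , ratio
  where
  open ≡-Reasoning
  n = suc m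
  q = productExponent n ∸ (2 * n + 1)
  numerator : 2 * 4 ^ (n + 1) ∸ (6 * n + 17) ≡ q * 9
  numerator = begin
    2 * 4 ^ (n + 1) ∸ (6 * n + 17)        ≡⟨ cong (_∸ (6 * n + 17)) (ratio-exponent m) ⟨
    9 * q + (6 * n + 17) ∸ (6 * n + 17)  ≡⟨ m+n∸n≡m (9 * q) (6 * n + 17) ⟩
    9 * q                                 ≡⟨ *-comm 9 q ⟩
    q * 9                                 ∎
  ratio : productDegrees (diamond n) ≡ 2 ^ ((2 * 4 ^ (n + 1) ∸ (6 * n + 17)) / 9) * sumDegrees (diamond n)
  ratio = begin
    productDegrees (diamond n)  ≡⟨ diamond-product n ⟩
    2 ^ productExponent n       ≡⟨ cong (2 ^_) (m∸n+n≡m (productExponent-lower m)) ⟨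
    2 ^ (q + (2 * n + 1))       ≡⟨ ^-distribˡ-+-* 2 q (2 * n + 1) ⟩
    2 ^ q * 2 ^ (2 * n + 1)
      ≡⟨ cong₂ (λ k S → 2 ^ k * S) (trans (cong (_/ 9) numerator) (m*n/n≡m q 9)) (diamond-sum n) ⟨
    2 ^ ((2 * 4 ^ (n + 1) ∸ (6 * n + 17)) / 9) * sumDegrees (diamond n) ∎
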